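{- Let $k\in\mathbb{N}$ and $r\in\mathbb{N}_+$. For every $k$-instructive tree decomposition $\tau\in\mathcal{T}_k$ and every local witness $w$ of $\mathsf{Chrom}_{\le r}[k]$, we have $w\in\mathrm{Dyn}_k(\tau)$ if and only if $\mathrm{Pred}(\tau,w)=1$.
   Context: Graphs are triples $(V,E,\rho)$, $V,E$ finite subsets of $\mathbb{N}$, $\rho\subseteq E\times V$, each edge incident to exactly two distinct vertices (parallel edges allowed). A proper $r$-coloring of a graph is a partition of its vertex set into at most $r$ cells such that the two endpoints of each edge lie in distinct cells. Instructive decompositions: the $k$-instructive alphabet has $\mathtt{Leaf}$ (arity 0), $\mathtt{IntroVertex}_u,\mathtt{ForgetVertex}_u$ ($u\in[k+1]$), $\mathtt{IntroEdge}_{u,v}$ (distinct $u,v\in[k+1]$) of arity 1 and $\mathtt{Join}$ of arity 2. $\mathcal{T}_k$ is the set of terms legal w.r.t. bags (Leaf: $\emptyset$; IntroVertex$_u$ needs $u\notin$ bag and adds it; ForgetVertex$_u$ needs $u\in$ bag and removes it; IntroEdge$_{u,v}$ needs $u,v\in$ bag; Join needs equal child bags). Each $\tau$ defines a graph $G(\tau)$, top bag $B(\tau)$ and injective map $\theta_\tau:B(\tau)\to V(G(\tau))$: Leaf gives the empty graph; IntroVertex$_u$ adds a fresh isolated vertex $x$ and sets $\theta(u)=x$; ForgetVertex$_u$ keeps the graph and restricts $\theta$; IntroEdge$_{u,v}$ adds a new edge between $\theta(u)$ and $\theta(v)$; Join takes the disjoint union of the children's graphs, identifies for each bag label $u$ the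 two vertices $\theta_{\sigma_1}(u),\theta_{\sigma_2}(u)$ (edges are never identified, and no other vertices are identified), with $\theta$ the image of the identified vertices. The core $\mathsf{Chrom}_{\le r}[k]$: local witnesses are $r$-partitions of subsets of $[k+1]$, i.e. sets of at most $r$ nonempty pairwise disjoint subsets ("cells") of $[k+1]$. $\mathtt{Leaf}=\{\emptyset\}$. $\mathtt{IntroVertex}_u(w)$: $\emptyset$ if $u\in\bigcup w$; otherwise the set of all $(w\setminus\{p\})\cup\{p\cup\{u\}\}$ for $p\in w$, together with $w\cup\{\{u\}\}$ if $|w|<r$. $\mathtt{ForgetVertex}_u(w)=\{\{p\setminus\{u\}:p\in w\}\setminus\{\emptyset\}\}$ if $u\in\bigcup w$, and $\emptyset$ otherwise. $\mathtt{IntroEdge}_{u,v}(w)=\{w\}$ if $u,v$ do not lie in a common cell of $w$, and $\emptyset$ otherwise. $\mathtt{Join}(w,w')=\{w\}$ if $w=w'$, $\emptyset$ otherwise. Every witness is final; cleaning is the identity. Transitions are lifted to finite witness sets by union, and the dynamization $\mathrm{Dyn}_k(\tau)$ is defined recursively: $\mathrm{Dyn}_k(\mathtt{Leaf})=\{\emptyset\}$, $\mathrm{Dyn}_k(\mathtt{IntroVertex}_u(\sigma))=\mathtt{IntroVertex}_u(\mathrm{Dyn}_k(\sigma))$, similarly for ForgetVertex and IntroEdge, and $\mathrm{Dyn}_k(\mathtt{Join}(\sigma_1,\sigma_2))=\bigcup_{w_1\in\mathrm{Dyn}_k(\sigma_1),w_2\in\mathrm{Dyn}_k(\sigma_2)}\mathtt{Join}(w_1,w_2)$.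 Predicate: $\mathrm{Pred}(\tau,w)=1$ iff (1) $\bigcup_{c\in w}c=B(\tau)$, and (2) there is a proper $r$-coloring $\alpha$ of $G(\tau)$ such that for all $u,v\in B(\tau)$, $\theta_\tau(u)$ and $\theta_\tau(v)$ lie in the same cell of $\alpha$ iff $u$ and $v$ lie in the same cell of $w$. -}

module Defs where

open import Data.Nat using (ℕ; zero; suc; _+_; _≤_; _<_; _≡ᵇ_)
open import Data.Bool using (Bool; true; false; _∧_; not)
open import Data.Fin using (Fin)
open import Data.Fin.Subset
  using (Subset; ⁅_⁆; _∈_; _∉_; _∪_; _∩_; _-_; ⋃; Nonempty; Empty)
  renaming (⊥ to ∅ₛ)
open import Data.Fin.Subset.Properties using (nonempty?)
open import Data.Vec using (lookup; _[_]≔_)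
open import Data.List using (List; []; _∷_; _++_; map; filter; length; findᵇ; allFin; upTo; filterᵇ)
open import Data.List.Relation.Unary.All using (All)
open import Data.List.Relation.Unary.Any using (Any; _∷=_)
open import Data.List.Relation.Unary.AllPairs using (AllPairs)
open import Data.List.Membership.Propositional using () renaming (_∈_ to _∈ₗ_)
open import Data.List.Relation.Binary.Permutation.Propositional using (_↭_)
open import Data.Maybe using (Maybe; just; nothing)
open import Data.Product using (Σ; ∃; ∃-syntax; _×_; _,_; proj₁; proj₂)
open import Data.Sum using (_⊎_)
open import Relation.Binary.PropositionalEquality using (_≡_; _≢_)
open import Relation.Nullary using (¬_)
open import Function.Bundles using (_⇔_)

-- Edge identities are
-- irrelevant for colourings, so an edge is represented by its endpoints.

record Graph : Set where
  field
    V : List ℕ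
    E : List (ℕ × ℕ)

-- A proper r-colouring: an assignment of one of r colours to the
-- vertices (the cells of the partition are the colour classes, hence at
-- most r of them) such that the endpoints of every edge get distinct
-- colours.
record ProperColouring (r : ℕ) (G : Graph) : Set where
  field
    colour : ℕ → Fin r
    proper : ∀ {e} → e ∈ₗ Graph.E G → colour (proj₁ e) ≢ colour (proj₂ e)

data Term (k : ℕ) : Set where
  Leaf        : Term k
  IntroVertex : Fin (suc k) → Term k → Term k
  ForgetVertex : Fin (suc k) → Term k → Term k
  IntroEdge   : (u v : Fin (suc k)) → u ≢ v → Term k → Term k
  Join        : Term k → Term k → Term k

-- the top bag B(τ)  (computed; meaningful for legal terms)
bag : ∀ {k} → Term k → Subset (suc k)
bag Leaf                   = ∅ₛ
bag (IntroVertex u σ)      = bag σ [ u ]≔ true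
bag (ForgetVertex u σ)     = bag σ [ u ]≔ false
bag (IntroEdge u v _ σ)    = bag σ
bag (Join σ₁ σ₂)           = bag σ₁

data Legal {k : ℕ} : Term k → Set where
  leaf   : Legal Leaf
  introV : ∀ {u σ} → Legal σ → u ∉ bag σ → Legal (IntroVertex u σ)
  forgetV : ∀ {u σ} → Legal σ → u ∈ bag σ → Legal (ForgetVertex u σ)
  introE : ∀ {u v σ} {u≢v : u ≢ v} → Legal σ → u ∈ bag σ → v ∈ bag σ →
           Legal (IntroEdge u v u≢v σ)
  join   : ∀ {σ₁ σ₂} → Legal σ₁ → Legal σ₂ → bag σ₁ ≡ bag σ₂ →
           Legal (Join σ₁ σ₂)

-- Semantics: G(τ) together with θ_τ.  Vertices are natural numbers, all
-- smaller than `fresh`; new vertices are taken to be `fresh`.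

record Sem (k : ℕ) : Set where
  field
    fresh : ℕ
    graph : Graph
    θ     : Fin (suc k) → ℕ     -- only meaningful on the bag

open Sem

preimage : ∀ {k} → Subset (suc k) → (Fin (suc k) → ℕ) → ℕ → Maybe (Fin (suc k))
preimage {k} B θ x = findᵇ (λ u → lookup B u ∧ (θ u ≡ᵇ x)) (allFin (suc k))

isNothing : ∀ {A : Set} → Maybe A → Bool
isNothing nothing  = true
isNothing (just _) = false

update : ∀ {k} → (Fin (suc k) → ℕ) → Fin (suc k) → ℕ → Fin (suc k) → ℕ
update {k} θ u n v with Data.Fin._≟_ u v
... | Relation.Nullary.yes _ = n
... | Relation.Nullary.no _  = θ v

-- relabelling of the second operand of a Join: a vertex θ₂(u) (u in the
-- bag) is identified with θ₁(u); any other vertex x becomes fresh₁ + x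
-- (disjoint union, the second copy being shifted above all first vertices)
ren : ∀ {k} → (Fin (suc k) → ℕ) → ℕ → ℕ → Maybe (Fin (suc k)) → ℕ
ren θ₁ n x (just u) = θ₁ u
ren θ₁ n x nothing  = n + x

joinMap : ∀ {k} → Subset (suc k) → (θ₁ θ₂ : Fin (suc k) → ℕ) → ℕ → ℕ → ℕ
joinMap B θ₁ θ₂ n x = ren θ₁ n x (preimage B θ₂ x)

mapEdge : (ℕ → ℕ) → ℕ × ℕ → ℕ × ℕ
mapEdge f (a , b) = (f a , f b)

sem : ∀ {k} → Term k → Sem k
sem Leaf = record { fresh = 0 ; graph = record { V = [] ; E = [] } ; θ = λ _ → 0 }
sem (IntroVertex u σ) =
  let s = sem σ in
  record { fresh = suc (fresh s)
         ; graph = record { V = fresh s ∷ Graph.V (graph s) ; E = Graph.E (graph s) }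
         ; θ = update (θ s) u (fresh s) }
sem (ForgetVertex u σ) = sem σ
sem (IntroEdge u v _ σ) =
  let s = sem σ in
  record { fresh = fresh s
         ; graph = record { V = Graph.V (graph s) ; E = (θ s u , θ s v) ∷ Graph.E (graph s) }
         ; θ = θ s }
sem (Join σ₁ σ₂) =
  let s₁ = sem σ₁ ; s₂ = sem σ₂ ; B = bag σ₂
      f = joinMap B (θ s₁) (θ s₂) (fresh s₁)
  in record { fresh = fresh s₁ + fresh s₂
            ; graph = record
                { V = Graph.V (graph s₁) ++
                      map (fresh s₁ +_) (filterᵇ (λ x → isNothing (preimage B (θ s₂) x)) (Graph.V (graph s₂)))
                ; E = Graph.E (graph s₁) ++ map (mapEdge f) (Graph.E (graph s₂)) }
            ; θ = θ s₁ }

G : ∀ {k} → Term k → Graph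
G τ = graph (sem τ)

thetaOf : ∀ {k} → Term k → Fin (suc k) → ℕ
thetaOf τ = Sem.θ (sem τ)

-- Local witnesses of Chrom_{≤ r}[k]: finite sets of cells, represented as
-- lists of subsets of [k+1]; sets are compared up to permutation (_↭_).

Witness : ℕ → Set
Witness k = List (Subset (suc k))

IsLocalWitness : ∀ {k} → ℕ → Witness k → Set
IsLocalWitness r w =
  All Nonempty w × AllPairs (λ p q → Empty (p ∩ q)) w × length w ≤ r

SameCell : ∀ {k} → Witness k → Fin (suc k) → Fin (suc k) → Set
SameCell w u v = ∃[ p ] (p ∈ₗ w × u ∈ p × v ∈ p)

-- transitions, as relations  "w' ∈ t(w)"
IntroVertexT : ∀ {k} → ℕ → Fin (suc k) → Witness k → Witness k → Set
IntroVertexT r u w w' =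
  u ∉ ⋃ w ×
  ((∃[ p ] Σ (p ∈ₗ w) λ p∈w → w' ↭ (p∈w ∷= (p ∪ ⁅ u ⁆)))
   ⊎ (length w < r × w' ↭ (⁅ u ⁆ ∷ w)))

ForgetVertexT : ∀ {k} → Fin (suc k) → Witness k → Witness k → Set
ForgetVertexT u w w' =
  u ∈ ⋃ w × w' ↭ filter nonempty? (map (_- u) w)

IntroEdgeT : ∀ {k} → Fin (suc k) → Fin (suc k) → Witness k → Witness k → Set
IntroEdgeT u v w w' = ¬ SameCell w u v × w' ↭ w

JoinT : ∀ {k} → Witness k → Witness k → Witness k → Set
JoinT w₁ w₂ w' = w₁ ↭ w₂ × w' ↭ w₁

data Dyn {k : ℕ} (r : ℕ) : Term k → Witness k → Set where
  leaf    : ∀ {w} → w ↭ [] → Dyn r Leaf w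
  introV  : ∀ {u σ w w'} → Dyn r σ w → IntroVertexT r u w w' →
            Dyn r (IntroVertex u σ) w'
  forgetV : ∀ {u σ w w'} → Dyn r σ w → ForgetVertexT u w w' →
            Dyn r (ForgetVertex u σ) w'
  introE  : ∀ {u v u≢v σ w w'} → Dyn r σ w → IntroEdgeT u v w w' →
            Dyn r (IntroEdge u v u≢v σ) w'
  join    : ∀ {σ₁ σ₂ w₁ w₂ w'} → Dyn r σ₁ w₁ → Dyn r σ₂ w₂ →
            JoinT w₁ w₂ w' → Dyn r (Join σ₁ σ₂) w'

Pred : ∀ {k} → ℕ → Term k → Witness k → Set
Pred r τ w =
  ⋃ w ≡ bag τ ×
  Σ (ProperColouring r (G τ)) λ α →
    ∀ u v → u ∈ bag τ → v ∈ bag τ →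
      (ProperColouring.colour α (thetaOf τ u) ≡ ProperColouring.colour α (thetaOf τ v)
        ⇔ SameCell w u v)

{-# OPTIONS --safe #-}

-- The induction has to fix colours and not only
-- classes: soundness shows that every colouring γ of the bag whose classes are the cells of w extends
-- to a proper colouring of G τ, so that the colourings of the two sides of a Join agree on the shared
-- bag.  Completeness peels off one constructor at a time and rebuilds the predecessor witness from the
-- colouring.  Only ForgetVertex needs counting: the forgotten vertex either shares its colour, hence
-- its cell, with a label still in the bag, or it forms a cell of its own; in the latter case its colour
-- is unused on the other cells, so there are fewer than r of them.

module Submission where

open import Defs
open import Data.Nat as ℕ using (ℕ; zero; suc; _+_; _∸_; _≤_; _<_; z≤n; s≤s)
import Data.Nat.Properties as ℕ
open import Data.Bool using (Bool; _∧_)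
open import Data.Bool.Properties using (∨-zeroʳ; ∨-identityʳ; T-≡; T-∧)
open import Data.Fin as Fin using (Fin; zero; suc; punchOut; inject≤)
import Data.Fin.Properties as Fin
open import Data.Fin.Subset
  using (Subset; inside; outside; ⁅_⁆; _∈_; _∉_; _⊆_; _∪_; _∩_; _-_; ⋃; Nonempty; Empty)
  renaming (⊥ to ∅)
open import Data.Fin.Subset.Properties
  using ( p─q⊆p; p─⊥≡p; x∈p∪q⁺; x∈p∪q⁻; x∈p∩q⁺; x∈p∩q⁻; x∈⁅x⁆; x∈⁅y⁆⇒x≡y; ∉⊥; ⊆-antisym
        ; Empty-unique; nonempty?; _∈?_; ∪-identityˡ; ∪-identityʳ)
open import Data.Vec using ([]; _∷_; lookup; _[_]≔_)
open import Data.Vec.Properties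
  using ([]≔-updates; []≔-minimal; []≔-lookup; []≔-idempotent; []=-injective; lookup⇒[]=; []=⇒lookup)
open import Data.List as List using (List; []; _∷_; _++_; map; filter; length)
open import Data.List.Properties using (length-map; length-filter; filter-accept; filter-reject)
open import Data.List.Membership.Propositional using (find; lose) renaming (_∈_ to _∈ₗ_)
open import Data.List.Membership.Propositional.Properties
  using (∈-allFin; ∈-lookup; ∈-++⁻; ∈-++⁺ˡ; ∈-++⁺ʳ; ∈-map⁺; ∈-map⁻; ∈-filter⁺; ∈-filter⁻)
open import Data.List.Relation.Unary.Any as Any using (Any; here; there; _∷=_)
open import Data.List.Relation.Unary.Any.Properties using (lookup-index)
open import Data.List.Relation.Unary.All as All using (All; []; _∷_)
open import Data.List.Relation.Unary.All.Properties using (¬Any⇒All¬; All¬⇒¬Any)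
open import Data.List.Relation.Unary.AllPairs as AllPairs using (AllPairs; []; _∷_)
import Data.List.Relation.Unary.AllPairs.Properties as AllPairs
open import Data.List.Relation.Binary.Permutation.Propositional
  using (_↭_; prep; swap; ↭-refl; ↭-reflexive; ↭-sym; ↭-trans; ↭⇒↭ₛ)
open import Data.List.Relation.Binary.Permutation.Propositional.Properties
  using (Any-resp-↭; All-resp-↭; ↭-length)
import Data.List.Relation.Binary.Permutation.Setoid.Properties as Permutationₛ
open import Data.Maybe using (just; nothing)
open import Data.Product using (Σ; ∃-syntax; _×_; _,_; proj₁; proj₂)
open import Data.Sum using (_⊎_; inj₁; inj₂; [_,_]′)
open import Function using (_∘_; Injective)
open import Function.Bundles using (_⇔_; mk⇔; Equivalence)
open import Function.Properties.Equivalence using () renaming (sym to ⇔-sym; trans to ⇔-trans)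
open import Relation.Binary.Definitions using (DecidableEquality)
open import Relation.Binary.PropositionalEquality
  using (_≡_; _≢_; refl; sym; trans; cong; cong₂; subst; resp₂; setoid; module ≡-Reasoning)
open import Relation.Nullary using (¬_; Dec; yes; no; contradiction)
open import Relation.Nullary.Decidable using (map′; _×-dec_; T?)
open import Relation.Unary using (Decidable)

private variable
  m n : ℕ
  A B : Set

injective-avoiding⇒< : {f : Fin m → Fin n} {j : Fin n} →
  Injective _≡_ _≡_ f → (∀ i → f i ≢ j) → m < n
injective-avoiding⇒< {n = zero}  {j = ()}
injective-avoiding⇒< {n = suc n} {f = f} {j} f-inj f≢j =
  s≤s (Fin.injective⇒≤ {f = λ i → punchOut (f≢j i ∘ sym)}
        (f-inj ∘ Fin.punchOut-injective (f≢j _ ∘ sym) (f≢j _ ∘ sym)))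

override : DecidableEquality A → (A → B) → A → B → A → B
override _≟_ f a b x with x ≟ a
... | yes _ = b
... | no  _ = f x

module _ (_≟_ : DecidableEquality A) (f : A → B) (a : A) (b : B) where

  override-same : override _≟_ f a b a ≡ b
  override-same with a ≟ a
  ... | yes _   = refl
  ... | no a≢a = contradiction refl a≢a

  override-other : ∀ {x} → x ≢ a → override _≟_ f a b x ≡ f x
  override-other {x} x≢a with x ≟ a
  ... | yes x≡a = contradiction x≡a x≢a
  ... | no  _   = refl

module _ {P : A → Set} (P? : Decidable P) where

  find-sound : ∀ xs {y} → List.find P? xs ≡ just y → P y
  find-sound (x ∷ xs) eq with P? x
  find-sound (x ∷ xs) refl | yes px = px
  ... | no _ = find-sound xs eq

  find-complete : ∀ {xs x} → x ∈ₗ xs → P x → ∃[ y ] List.find P? xs ≡ just y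
  find-complete {x ∷ xs} x∈ px with P? x
  ... | yes _ = x , refl
  find-complete (here refl) px | no ¬px = contradiction px ¬px
  find-complete (there x∈) px  | no _   = find-complete x∈ px

↭-extract : ∀ {xs : List A} {x} (x∈xs : x ∈ₗ xs) → xs ↭ x ∷ (xs Any.─ x∈xs)
↭-extract (here refl)               = ↭-refl
↭-extract {xs = y ∷ _} (there x∈xs) = ↭-trans (prep y (↭-extract x∈xs)) (swap y _ ↭-refl)

∷=-↭ : ∀ {xs : List A} {x} (x∈xs : x ∈ₗ xs) z → (x∈xs ∷= z) ↭ z ∷ (xs Any.─ x∈xs)
∷=-↭ (here refl)               z = ↭-refl
∷=-↭ {xs = y ∷ _} (there x∈xs) z = ↭-trans (prep y (∷=-↭ x∈xs z)) (swap y _ ↭-refl)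

subset-ext : ∀ {p q : Subset n} → (∀ {x} → x ∈ p ⇔ x ∈ q) → p ≡ q
subset-ext p⇔q = ⊆-antisym (Equivalence.to p⇔q) (Equivalence.from p⇔q)

module _ {p : Subset n} {x y : Fin n} {b : Bool} where

  ∈-[]≔-≢ : y ≢ x → y ∈ p [ x ]≔ b ⇔ y ∈ p
  ∈-[]≔-≢ y≢x = mk⇔
    (λ y∈ → lookup⇒[]= y p ([]=-injective ([]≔-minimal p y x y≢x (lookup⇒[]= y p refl)) y∈))
    ([]≔-minimal p y x y≢x)

x∈p[y]≔outside⇒x≢y : ∀ (p : Subset n) y {x} → x ∈ p [ y ]≔ outside → x ≢ y
x∈p[y]≔outside⇒x≢y p y x∈ refl with () ← []=-injective x∈ ([]≔-updates p y)

∉⇒lookup≡outside : ∀ (p : Subset n) x → x ∉ p → lookup p x ≡ outside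
∉⇒lookup≡outside p x x∉ with lookup p x in eq
... | inside  = contradiction (lookup⇒[]= x p eq) x∉
... | outside = refl

[]≔-cancel : ∀ {p q : Subset n} x {b} → p [ x ]≔ b ≡ q [ x ]≔ b → lookup p x ≡ lookup q x → p ≡ q
[]≔-cancel {p = p} {q} x {b} eq px≡qx = begin
  p                              ≡⟨ []≔-lookup p x ⟨
  p [ x ]≔ lookup p x            ≡⟨ []≔-idempotent p x ⟨
  p [ x ]≔ b [ x ]≔ lookup p x   ≡⟨ cong₂ (λ s c → s [ x ]≔ c) eq px≡qx ⟩
  q [ x ]≔ b [ x ]≔ lookup q x   ≡⟨ []≔-idempotent q x ⟩
  q [ x ]≔ lookup q x            ≡⟨ []≔-lookup q x ⟩
  q                              ∎
  where open ≡-Reasoning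

p∪⁅x⁆≡p[x]≔inside : ∀ (p : Subset n) x → p ∪ ⁅ x ⁆ ≡ p [ x ]≔ inside
p∪⁅x⁆≡p[x]≔inside (b ∷ p) zero    = cong₂ _∷_ (∨-zeroʳ b) (∪-identityʳ p)
p∪⁅x⁆≡p[x]≔inside (b ∷ p) (suc x) = cong₂ _∷_ (∨-identityʳ b) (p∪⁅x⁆≡p[x]≔inside p x)

p-x≡p[x]≔outside : ∀ (p : Subset n) x → p - x ≡ p [ x ]≔ outside
p-x≡p[x]≔outside (b ∷ p) zero    = cong (outside ∷_) (p─⊥≡p p)
p-x≡p[x]≔outside (b ∷ p) (suc x) = cong (b ∷_) (p-x≡p[x]≔outside p x)

module _ {p : Subset n} {x : Fin n} where

  x∈p∪⁅x⁆ : x ∈ p ∪ ⁅ x ⁆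
  x∈p∪⁅x⁆ = x∈p∪q⁺ (inj₂ (x∈⁅x⁆ x))

  x∉p-x : x ∉ p - x
  x∉p-x x∈ = x∈p[y]≔outside⇒x≢y p x (subst (x ∈_) (p-x≡p[x]≔outside p x) x∈) refl

  ∈-∪⁅⁆-≢ : ∀ {y} → y ≢ x → y ∈ p ∪ ⁅ x ⁆ ⇔ y ∈ p
  ∈-∪⁅⁆-≢ {y} y≢x = subst (λ q → y ∈ q ⇔ y ∈ p) (sym (p∪⁅x⁆≡p[x]≔inside p x)) (∈-[]≔-≢ y≢x)

  ∈-─⁅⁆-≢ : ∀ {y} → y ≢ x → y ∈ p - x ⇔ y ∈ p
  ∈-─⁅⁆-≢ {y} y≢x = subst (λ q → y ∈ q ⇔ y ∈ p) (sym (p-x≡p[x]≔outside p x)) (∈-[]≔-≢ y≢x)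

  x∉p⇒p-x≡p : x ∉ p → p - x ≡ p
  x∉p⇒p-x≡p x∉p = begin
    p - x                 ≡⟨ p-x≡p[x]≔outside p x ⟩
    p [ x ]≔ outside      ≡⟨ cong (p [ x ]≔_) (∉⇒lookup≡outside p x x∉p) ⟨
    p [ x ]≔ lookup p x   ≡⟨ []≔-lookup p x ⟩
    p                     ∎
    where open ≡-Reasoning

  p∪⁅x⁆-x≡p-x : (p ∪ ⁅ x ⁆) - x ≡ p - x
  p∪⁅x⁆-x≡p-x = begin
    (p ∪ ⁅ x ⁆) - x                  ≡⟨ p-x≡p[x]≔outside _ x ⟩
    (p ∪ ⁅ x ⁆) [ x ]≔ outside       ≡⟨ cong (_[ x ]≔ outside) (p∪⁅x⁆≡p[x]≔inside p x) ⟩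
    p [ x ]≔ inside [ x ]≔ outside   ≡⟨ []≔-idempotent p x ⟩
    p [ x ]≔ outside                 ≡⟨ p-x≡p[x]≔outside p x ⟨
    p - x                            ∎
    where open ≡-Reasoning

  x∈p⇒p-x∪⁅x⁆≡p : x ∈ p → (p - x) ∪ ⁅ x ⁆ ≡ p
  x∈p⇒p-x∪⁅x⁆≡p x∈p = begin
    (p - x) ∪ ⁅ x ⁆                  ≡⟨ p∪⁅x⁆≡p[x]≔inside _ x ⟩
    (p - x) [ x ]≔ inside            ≡⟨ cong (_[ x ]≔ inside) (p-x≡p[x]≔outside p x) ⟩
    p [ x ]≔ outside [ x ]≔ inside   ≡⟨ []≔-idempotent p x ⟩
    p [ x ]≔ inside                  ≡⟨ cong (p [ x ]≔_) ([]=⇒lookup x∈p) ⟨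
    p [ x ]≔ lookup p x              ≡⟨ []≔-lookup p x ⟩
    p                                ∎
    where open ≡-Reasoning

  x∈p∧Empty[p-x]⇒p≡⁅x⁆ : x ∈ p → Empty (p - x) → p ≡ ⁅ x ⁆
  x∈p∧Empty[p-x]⇒p≡⁅x⁆ x∈p p-x≡∅ = begin
    p                  ≡⟨ x∈p⇒p-x∪⁅x⁆≡p x∈p ⟨
    (p - x) ∪ ⁅ x ⁆    ≡⟨ cong (_∪ ⁅ x ⁆) (Empty-unique p-x≡∅) ⟩
    ∅ ∪ ⁅ x ⁆          ≡⟨ ∪-identityˡ _ ⟩
    ⁅ x ⁆              ∎
    where open ≡-Reasoning

Disjoint : Subset n → Subset n → Set
Disjoint p q = Empty (p ∩ q)

module _ {p q : Subset n} where

  disjoint⇒∉ : Disjoint p q → ∀ {x} → x ∈ p → x ∉ q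
  disjoint⇒∉ p∩q≡∅ x∈p x∈q = p∩q≡∅ (_ , x∈p∩q⁺ (x∈p , x∈q))

  ∉⇒disjoint : (∀ {x} → x ∈ p → x ∉ q) → Disjoint p q
  ∉⇒disjoint p∌q (_ , x∈p∩q) = let x∈p , x∈q = x∈p∩q⁻ p q x∈p∩q in p∌q x∈p x∈q

disjoint-sym : ∀ {p q : Subset n} → Disjoint p q → Disjoint q p
disjoint-sym p∩q≡∅ = ∉⇒disjoint (λ x∈q x∈p → disjoint⇒∉ p∩q≡∅ x∈p x∈q)

disjoint-mono : ∀ {p p′ q q′ : Subset n} → p′ ⊆ p → q′ ⊆ q → Disjoint p q → Disjoint p′ q′
disjoint-mono p′⊆p q′⊆q p∩q≡∅ = ∉⇒disjoint λ x∈p′ → disjoint⇒∉ p∩q≡∅ (p′⊆p x∈p′) ∘ q′⊆q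

disjoint-⁅⁆ : ∀ {q : Subset n} {x} → x ∉ q → Disjoint ⁅ x ⁆ q
disjoint-⁅⁆ {x = x} x∉q = ∉⇒disjoint λ y∈⁅x⁆ → subst (_∉ _) (sym (x∈⁅y⁆⇒x≡y x y∈⁅x⁆)) x∉q

disjoint-∪⁅⁆ : ∀ {p q : Subset n} {x} → x ∉ q → Disjoint p q → Disjoint (p ∪ ⁅ x ⁆) q
disjoint-∪⁅⁆ {p = p} {x = x} x∉q p∩q≡∅ = ∉⇒disjoint λ y∈p∪⁅x⁆ →
  [ disjoint⇒∉ p∩q≡∅ , disjoint⇒∉ (disjoint-⁅⁆ x∉q) ]′ (x∈p∪q⁻ p ⁅ x ⁆ y∈p∪⁅x⁆)

∈⋃⁺ : ∀ {w : List (Subset n)} {x} → Any (x ∈_) w → x ∈ ⋃ w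
∈⋃⁺ (here x∈p)  = x∈p∪q⁺ (inj₁ x∈p)
∈⋃⁺ (there x∈w) = x∈p∪q⁺ (inj₂ (∈⋃⁺ x∈w))

∈⋃⁻ : ∀ (w : List (Subset n)) {x} → x ∈ ⋃ w → Any (x ∈_) w
∈⋃⁻ []      x∈ = contradiction x∈ ∉⊥
∈⋃⁻ (p ∷ w) x∈ = [ here , there ∘ ∈⋃⁻ w ]′ (x∈p∪q⁻ p (⋃ w) x∈)

∉⋃⇒∉cells : ∀ {w : List (Subset n)} {x} → x ∉ ⋃ w → All (x ∉_) w
∉⋃⇒∉cells {w = w} x∉ = ¬Any⇒All¬ w (x∉ ∘ ∈⋃⁺)

⋃-resp-↭ : ∀ {w w′ : List (Subset n)} → w ↭ w′ → ⋃ w ≡ ⋃ w′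
⋃-resp-↭ w↭w′ =
  ⊆-antisym (∈⋃⁺ ∘ Any-resp-↭ w↭w′ ∘ ∈⋃⁻ _) (∈⋃⁺ ∘ Any-resp-↭ (↭-sym w↭w′) ∘ ∈⋃⁻ _)

allPairs-disjoint-resp-↭ : ∀ {w w′ : List (Subset n)} → w ↭ w′ →
  AllPairs Disjoint w → AllPairs Disjoint w′
allPairs-disjoint-resp-↭ w↭w′ =
  Permutationₛ.AllPairs-resp-↭ (setoid _) disjoint-sym (resp₂ Disjoint) (↭⇒↭ₛ w↭w′)

module _ {x : Fin n} {R : List (Subset n)} (x∉R : All (x ∉_) R) where

  allPairs-disjoint-∪⁅⁆ : ∀ {p} → AllPairs Disjoint (p ∷ R) → AllPairs Disjoint ((p ∪ ⁅ x ⁆) ∷ R)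
  allPairs-disjoint-∪⁅⁆ (p∩R≡∅ ∷ disjR) =
    All.zipWith (λ (x∉c , p∩c≡∅) → disjoint-∪⁅⁆ x∉c p∩c≡∅) (x∉R , p∩R≡∅) ∷ disjR

  allPairs-disjoint-⁅⁆∷ : AllPairs Disjoint R → AllPairs Disjoint (⁅ x ⁆ ∷ R)
  allPairs-disjoint-⁅⁆∷ disjR = All.map disjoint-⁅⁆ x∉R ∷ disjR

lookup-unique : ∀ {w : List (Subset n)} → AllPairs Disjoint w →
  ∀ {x} i j → x ∈ List.lookup w i → x ∈ List.lookup w j → i ≡ j
lookup-unique (_ ∷ _)     zero    zero    _   _   = refl
lookup-unique (p∩w≡∅ ∷ _) zero    (suc j) x∈p x∈q =
  contradiction x∈q (disjoint⇒∉ (All.lookup p∩w≡∅ (∈-lookup j)) x∈p)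
lookup-unique (p∩w≡∅ ∷ _) (suc i) zero    x∈q x∈p =
  contradiction x∈q (disjoint⇒∉ (All.lookup p∩w≡∅ (∈-lookup i)) x∈p)
lookup-unique (_ ∷ disj)  (suc i) (suc j) x∈p x∈q = cong suc (lookup-unique disj i j x∈p x∈q)

cell-unique : ∀ {w : List (Subset n)} → AllPairs Disjoint w →
  ∀ {p q x} → p ∈ₗ w → q ∈ₗ w → x ∈ p → x ∈ q → p ≡ q
cell-unique {w = w} disj {x = x} p∈w q∈w x∈p x∈q = begin
  _                               ≡⟨ lookup-index p∈w ⟩
  List.lookup w (Any.index p∈w)   ≡⟨ cong (List.lookup w)
                                       (lookup-unique disj _ _ (at p∈w x∈p) (at q∈w x∈q)) ⟩
  List.lookup w (Any.index q∈w)   ≡⟨ lookup-index q∈w ⟨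
  _                               ∎
  where
  open ≡-Reasoning
  at : ∀ {p} (p∈w : p ∈ₗ w) → x ∈ p → x ∈ List.lookup w (Any.index p∈w)
  at p∈w = subst (x ∈_) (lookup-index p∈w)

removeLabel : Fin n → List (Subset n) → List (Subset n)
removeLabel x w = filter nonempty? (map (_- x) w)

module _ {x : Fin n} where

  removeLabel-fresh : ∀ {w : List (Subset n)} → All (x ∉_) w → All Nonempty w → removeLabel x w ≡ w
  removeLabel-fresh []          []          = refl
  removeLabel-fresh (x∉p ∷ x∉w) (p≢∅ ∷ w≢∅) = trans
    (filter-accept nonempty? (subst Nonempty (sym (x∉p⇒p-x≡p x∉p)) p≢∅))
    (cong₂ _∷_ (x∉p⇒p-x≡p x∉p) (removeLabel-fresh x∉w w≢∅))

  removeLabel-∪⁅⁆ : ∀ {p} {w : List (Subset n)} → removeLabel x ((p ∪ ⁅ x ⁆) ∷ w) ≡ removeLabel x (p ∷ w)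
  removeLabel-∪⁅⁆ {w = w} = cong (λ c → filter nonempty? (c ∷ map (_- x) w)) p∪⁅x⁆-x≡p-x

  removeLabel-⁅⁆ : ∀ {w : List (Subset n)} → removeLabel x (⁅ x ⁆ ∷ w) ≡ removeLabel x w
  removeLabel-⁅⁆ = filter-reject nonempty? λ (y , y∈) →
    x∉p-x (subst (_∈ ⁅ x ⁆ - x) (x∈⁅y⁆⇒x≡y x (p─q⊆p _ _ y∈)) y∈)

module _ {x : Fin n} {w : List (Subset n)} where

  removeLabel-cell⁺ : ∀ {p y} → p ∈ₗ w → y ∈ p → y ≢ x → p - x ∈ₗ removeLabel x w
  removeLabel-cell⁺ p∈w y∈p y≢x =
    ∈-filter⁺ nonempty? (∈-map⁺ (_- x) p∈w) (_ , Equivalence.from (∈-─⁅⁆-≢ y≢x) y∈p)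

  removeLabel-cell⁻ : ∀ {q} → q ∈ₗ removeLabel x w → ∃[ p ] p ∈ₗ w × q ≡ p - x
  removeLabel-cell⁻ q∈ = ∈-map⁻ (_- x) (proj₁ (∈-filter⁻ nonempty? q∈))

  removeLabel-disjoint : AllPairs Disjoint w → AllPairs Disjoint (removeLabel x w)
  removeLabel-disjoint =
    AllPairs.filter⁺ nonempty? ∘ AllPairs.map⁺ ∘ AllPairs.map (disjoint-mono (p─q⊆p _ _) (p─q⊆p _ _))

  removeLabel-length : length (removeLabel x w) ≤ length w
  removeLabel-length = ℕ.≤-trans (length-filter nonempty? (map (_- x) w)) (ℕ.≤-reflexive (length-map (_- x) w))

module _ {k : ℕ} {w : Witness k} where

  sameCell-refl : ∀ {x} → x ∈ ⋃ w → SameCell w x x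
  sameCell-refl x∈ = let p , p∈w , x∈p = find (∈⋃⁻ w x∈) in p , p∈w , x∈p , x∈p

  sameCell-sym : ∀ {x y} → SameCell w x y → SameCell w y x
  sameCell-sym (p , p∈w , x∈p , y∈p) = p , p∈w , y∈p , x∈p

  sameCell-trans : AllPairs Disjoint w → ∀ {x y z} → SameCell w x y → SameCell w y z → SameCell w x z
  sameCell-trans disj (p , p∈w , x∈p , y∈p) (q , q∈w , y∈q , z∈q)
    with refl ← cell-unique disj p∈w q∈w y∈p y∈q = p , p∈w , x∈p , z∈q

  sameCell? : ∀ x y → Dec (SameCell w x y)
  sameCell? x y = map′ find (λ (_ , p∈w , x∈p , y∈p) → lose p∈w (x∈p , y∈p))
    (Any.any? (λ p → x ∈? p ×-dec y ∈? p) w)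

  sameCell-⇔-sym : ∀ {x y} → SameCell w x y ⇔ SameCell w y x
  sameCell-⇔-sym = mk⇔ sameCell-sym sameCell-sym

  ∈⋃⇔sameCell : ∀ {x} → x ∈ ⋃ w ⇔ SameCell w x x
  ∈⋃⇔sameCell = mk⇔ sameCell-refl (λ (_ , p∈w , x∈p , _) → ∈⋃⁺ (lose p∈w x∈p))

  lookup-sameCell : ∀ {x y} i → x ∈ List.lookup w i → y ∈ List.lookup w i → SameCell w x y
  lookup-sameCell i x∈ y∈ = List.lookup w i , ∈-lookup i , x∈ , y∈

  sameCell-lookup-unique : AllPairs Disjoint w → ∀ {x y} → SameCell w x y →
    ∀ {i j} → x ∈ List.lookup w i → y ∈ List.lookup w j → i ≡ j
  sameCell-lookup-unique disj (p , p∈w , x∈p , y∈p) x∈i y∈j =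
    trans (lookup-unique disj _ _ x∈i (at x∈p)) (lookup-unique disj _ _ (at y∈p) y∈j)
    where
    at : ∀ {x} → x ∈ p → x ∈ List.lookup w (Any.index p∈w)
    at = subst (_ ∈_) (lookup-index p∈w)

sameCell-resp-↭ : ∀ {k} {w w′ : Witness k} → w ↭ w′ → ∀ {x y} → SameCell w x y ⇔ SameCell w′ x y
sameCell-resp-↭ w↭w′ = mk⇔
  (λ (p , p∈w , x∈p , y∈p) → p , Any-resp-↭ w↭w′ p∈w , x∈p , y∈p)
  (λ (p , p∈w′ , x∈p , y∈p) → p , Any-resp-↭ (↭-sym w↭w′) p∈w′ , x∈p , y∈p)

module _ {k : ℕ} where

  AgreeOff : Fin (suc k) → Witness k → Witness k → Set
  AgreeOff u w w′ = ∀ {x y} → x ≢ u → y ≢ u → SameCell w x y ⇔ SameCell w′ x y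

  module _ {u : Fin (suc k)} where

    agreeOff-trans : ∀ {w₁ w₂ w₃} → AgreeOff u w₁ w₂ → AgreeOff u w₂ w₃ → AgreeOff u w₁ w₃
    agreeOff-trans w₁≈w₂ w₂≈w₃ x≢u y≢u = ⇔-trans (w₁≈w₂ x≢u y≢u) (w₂≈w₃ x≢u y≢u)

    agreeOff-↭ : ∀ {w w′} → w ↭ w′ → AgreeOff u w w′
    agreeOff-↭ w↭w′ _ _ = sameCell-resp-↭ w↭w′

    agreeOff-∷ : ∀ {p q R} → (∀ {x} → x ≢ u → x ∈ p ⇔ x ∈ q) → AgreeOff u (p ∷ R) (q ∷ R)
    agreeOff-∷ {p} {q} {R} p≈q x≢u y≢u = mk⇔ (move p≈q) (move (⇔-sym ∘ p≈q))
      where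
      move : ∀ {p q} → (∀ {x} → x ≢ u → x ∈ p ⇔ x ∈ q) → SameCell (p ∷ R) _ _ → SameCell (q ∷ R) _ _
      move p≈q (_ , here refl , x∈p , y∈p) =
        _ , here refl , Equivalence.to (p≈q x≢u) x∈p , Equivalence.to (p≈q y≢u) y∈p
      move _   (c , there c∈R , x∈c , y∈c) = c , there c∈R , x∈c , y∈c

    agreeOff-⁅⁆∷ : ∀ {R} → AgreeOff u R (⁅ u ⁆ ∷ R)
    agreeOff-⁅⁆∷ x≢u _ = mk⇔ (λ (c , c∈R , x∈c , y∈c) → c , there c∈R , x∈c , y∈c) λ where
      (_ , here refl , x∈u , _)   → contradiction (x∈⁅y⁆⇒x≡y u x∈u) x≢u
      (c , there c∈R , x∈c , y∈c) → c , c∈R , x∈c , y∈c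

    agreeOff-removeLabel : ∀ {w} → AgreeOff u w (removeLabel u w)
    agreeOff-removeLabel x≢u y≢u = mk⇔
      (λ (p , p∈w , x∈p , y∈p) → p - u , removeLabel-cell⁺ p∈w x∈p x≢u ,
          Equivalence.from (∈-─⁅⁆-≢ x≢u) x∈p , Equivalence.from (∈-─⁅⁆-≢ y≢u) y∈p)
      (λ (q , q∈ , x∈q , y∈q) → let p , p∈w , q≡p-u = removeLabel-cell⁻ q∈ in
          p , p∈w , Equivalence.to (∈-─⁅⁆-≢ x≢u) (subst (_ ∈_) q≡p-u x∈q)
                  , Equivalence.to (∈-─⁅⁆-≢ y≢u) (subst (_ ∈_) q≡p-u y∈q))

  ⋃-agreeOff : ∀ {u w w′ b} → AgreeOff u w w′ → (u ∈ ⋃ w′ ⇔ u ∈ ⋃ w [ u ]≔ b) → ⋃ w′ ≡ ⋃ w [ u ]≔ b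
  ⋃-agreeOff {u} {w} {w′} {b} w≈w′ u∈⇔ = subset-ext λ {x} → by-label (x Fin.≟ u)
    where
    by-label : ∀ {x} → Dec (x ≡ u) → x ∈ ⋃ w′ ⇔ x ∈ ⋃ w [ u ]≔ b
    by-label (yes refl) = u∈⇔
    by-label (no x≢u)   = ⇔-trans ∈⋃⇔sameCell (⇔-trans (⇔-sym (w≈w′ x≢u x≢u))
                            (⇔-trans (⇔-sym ∈⋃⇔sameCell) (⇔-sym (∈-[]≔-≢ x≢u))))

  module _ {r : ℕ} {u : Fin (suc k)} {w w′ : Witness k} where

    introVertexT-agreeOff : IntroVertexT r u w w′ → AgreeOff u w w′
    introVertexT-agreeOff (_ , inj₁ (p , p∈w , w′↭)) =
      agreeOff-trans (agreeOff-↭ (↭-extract p∈w)) (agreeOff-trans (agreeOff-∷ (⇔-sym ∘ ∈-∪⁅⁆-≢))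
        (agreeOff-↭ (↭-sym (↭-trans w′↭ (∷=-↭ p∈w _)))))
    introVertexT-agreeOff (_ , inj₂ (_ , w′↭)) = agreeOff-trans agreeOff-⁅⁆∷ (agreeOff-↭ (↭-sym w′↭))

    introVertexT-⋃ : IntroVertexT r u w w′ → ⋃ w′ ≡ ⋃ w [ u ]≔ inside
    introVertexT-⋃ t =
      ⋃-agreeOff (introVertexT-agreeOff t) (mk⇔ (λ _ → []≔-updates (⋃ w) u) (λ _ → u∈⋃w′ t))
      where
      u∈⋃w′ : IntroVertexT r u w w′ → u ∈ ⋃ w′
      u∈⋃w′ (_ , inj₁ (p , p∈w , w′↭)) =
        ∈⋃⁺ (Any-resp-↭ (↭-sym (↭-trans w′↭ (∷=-↭ p∈w _))) (here x∈p∪⁅x⁆))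
      u∈⋃w′ (_ , inj₂ (_ , w′↭))       = ∈⋃⁺ (Any-resp-↭ (↭-sym w′↭) (here (x∈⁅x⁆ u)))

    introVertexT-disjoint : IntroVertexT r u w w′ → AllPairs Disjoint w → AllPairs Disjoint w′
    introVertexT-disjoint (u∉ , inj₁ (p , p∈w , w′↭)) disj
      with _ ∷ u∉R ← ∉⋃⇒∉cells (subst (u ∉_) (⋃-resp-↭ (↭-extract p∈w)) u∉) =
      allPairs-disjoint-resp-↭ (↭-sym (↭-trans w′↭ (∷=-↭ p∈w _)))
        (allPairs-disjoint-∪⁅⁆ u∉R (allPairs-disjoint-resp-↭ (↭-extract p∈w) disj))
    introVertexT-disjoint (u∉ , inj₂ (_ , w′↭)) disj =
      allPairs-disjoint-resp-↭ (↭-sym w′↭) (allPairs-disjoint-⁅⁆∷ (∉⋃⇒∉cells u∉) disj)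

    introVertexT-length : IntroVertexT r u w w′ → length w ≤ r → length w′ ≤ r
    introVertexT-length (_ , inj₁ (p , p∈w , w′↭)) |w|≤r = begin
      length w′                   ≡⟨ ↭-length (↭-trans w′↭ (∷=-↭ p∈w _)) ⟩
      suc (length (w Any.─ p∈w))  ≡⟨ ↭-length (↭-extract p∈w) ⟨
      length w                    ≤⟨ |w|≤r ⟩
      r                           ∎
      where open ℕ.≤-Reasoning
    introVertexT-length (_ , inj₂ (|w|<r , w′↭)) _ = ℕ.≤-trans (ℕ.≤-reflexive (↭-length w′↭)) |w|<r

  module _ {u : Fin (suc k)} {w w′ : Witness k} (t : ForgetVertexT u w w′) where

    private
      w′↭ = proj₂ t

    forgetVertexT-agreeOff : AgreeOff u w w′
    forgetVertexT-agreeOff = agreeOff-trans agreeOff-removeLabel (agreeOff-↭ (↭-sym w′↭))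

    forgetVertexT-⋃ : ⋃ w′ ≡ ⋃ w [ u ]≔ outside
    forgetVertexT-⋃ = ⋃-agreeOff forgetVertexT-agreeOff
      (mk⇔ (λ u∈ → contradiction (Any-resp-↭ w′↭ (∈⋃⁻ w′ u∈)) u∉removeLabel)
           (λ u∈ → contradiction refl (x∈p[y]≔outside⇒x≢y (⋃ w) u u∈)))
      where
      u∉removeLabel : ¬ Any (u ∈_) (removeLabel u w)
      u∉removeLabel u∈ = let q , q∈ , u∈q = find u∈ ; _ , _ , q≡p-u = removeLabel-cell⁻ {w = w} q∈ in
        x∉p-x (subst (u ∈_) q≡p-u u∈q)

    forgetVertexT-disjoint : AllPairs Disjoint w → AllPairs Disjoint w′
    forgetVertexT-disjoint = allPairs-disjoint-resp-↭ (↭-sym w′↭) ∘ removeLabel-disjoint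

    forgetVertexT-length : length w′ ≤ length w
    forgetVertexT-length = ℕ.≤-trans (ℕ.≤-reflexive (↭-length w′↭)) (removeLabel-length {x = u} {w = w})

module _ {k : ℕ} where

  -- Phrased as the colour condition of Pred, so that Pred r τ w is ⋃ w ≡ bag τ together with a proper
  -- colouring α such that Represents w (bag τ) (colour α ∘ thetaOf τ).
  Represents : {C : Set} → Witness k → Subset (suc k) → (Fin (suc k) → C) → Set
  Represents w B γ = ∀ u v → u ∈ B → v ∈ B → (γ u ≡ γ v ⇔ SameCell w u v)

  module _ {C : Set} {w : Witness k} {B : Subset (suc k)} where

    represents-cong : ∀ {γ δ : Fin (suc k) → C} → (∀ {x} → x ∈ B → γ x ≡ δ x) →
      Represents w B γ → Represents w B δ
    represents-cong γ≗δ rep x y x∈ y∈ = ⇔-trans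
      (mk⇔ (λ δx≡δy → trans (γ≗δ x∈) (trans δx≡δy (sym (γ≗δ y∈))))
           (λ γx≡γy → trans (sym (γ≗δ x∈)) (trans γx≡γy (γ≗δ y∈))))
      (rep x y x∈ y∈)

    represents-⊆ : ∀ {B′} {γ : Fin (suc k) → C} → B ⊆ B′ → Represents w B′ γ → Represents w B γ
    represents-⊆ B⊆B′ rep x y x∈ y∈ = rep x y (B⊆B′ x∈) (B⊆B′ y∈)

    represents-↭ : ∀ {w′} {γ : Fin (suc k) → C} → w ↭ w′ → Represents w B γ → Represents w′ B γ
    represents-↭ w↭w′ rep x y x∈ y∈ = ⇔-trans (rep x y x∈ y∈) (sameCell-resp-↭ w↭w′)

    represents-agreeOff : ∀ {u w′} {γ : Fin (suc k) → C} → AgreeOff u w w′ → (∀ {x} → x ∈ B → x ≢ u) →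
      Represents w′ B γ → Represents w B γ
    represents-agreeOff w≈w′ off rep x y x∈ y∈ = ⇔-trans (rep x y x∈ y∈) (⇔-sym (w≈w′ (off x∈) (off y∈)))

    represents-insert : ∀ {u} {γ : Fin (suc k) → C} → u ∈ ⋃ w → Represents w (B [ u ]≔ outside) γ →
      (∀ y → y ∈ B [ u ]≔ outside → γ u ≡ γ y ⇔ SameCell w u y) → Represents w B γ
    represents-insert {u} u∈⋃ rep u-row x y x∈ y∈ with x Fin.≟ u | y Fin.≟ u
    ... | yes refl | yes refl = mk⇔ (λ _ → sameCell-refl u∈⋃) (λ _ → refl)
    ... | yes refl | no y≢u   = u-row y ([]≔-minimal B y u y≢u y∈)
    ... | no x≢u   | yes refl =
      ⇔-trans (mk⇔ sym sym) (⇔-trans (u-row x ([]≔-minimal B x u x≢u x∈)) sameCell-⇔-sym)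
    ... | no x≢u   | no y≢u   = rep x y ([]≔-minimal B x u x≢u x∈) ([]≔-minimal B y u y≢u y∈)

    represents-sameCell : ∀ {u v} {γ : Fin (suc k) → C} → AllPairs Disjoint w → Represents w B γ →
      v ∈ B → SameCell w u v → ∀ y → y ∈ B → γ v ≡ γ y ⇔ SameCell w u y
    represents-sameCell disj rep v∈ u~v y y∈ = ⇔-trans (rep _ y v∈ y∈)
      (mk⇔ (sameCell-trans disj u~v) (sameCell-trans disj (sameCell-sym u~v)))

module _ {k : ℕ} {C : Set} {w : Witness k} {B : Subset (suc k)} {u : Fin (suc k)} {γ : Fin (suc k) → C} where

  represents-introVertex : ∀ {w′} → u ∉ B → AgreeOff u w w′ → Represents w′ (B [ u ]≔ inside) γ →
    Represents w B γ
  represents-introVertex u∉B w≈w′ rep =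
    represents-agreeOff w≈w′ off (represents-⊆ (λ x∈ → []≔-minimal B _ u (off x∈) x∈) rep)
    where
    off : ∀ {x} → x ∈ B → x ≢ u
    off x∈ refl = u∉B x∈

  represents-forgotten : ∀ {w′} → ForgetVertexT u w w′ → Represents w′ (B [ u ]≔ outside) γ →
    Represents w (B [ u ]≔ outside) γ
  represents-forgotten t = represents-agreeOff (forgetVertexT-agreeOff t) (x∈p[y]≔outside⇒x≢y B u)

module _ {k r : ℕ} {w : Witness k} {B : Subset (suc k)} {u : Fin (suc k)} {γ : Fin (suc k) → Fin r} where

  represents-override : ∀ {c} → u ∈ ⋃ w → Represents w (B [ u ]≔ outside) γ →
    (∀ y → y ∈ B [ u ]≔ outside → c ≡ γ y ⇔ SameCell w u y) → Represents w B (override Fin._≟_ γ u c)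
  represents-override {c} u∈⋃ rep u-row = represents-insert u∈⋃
    (represents-cong (λ x∈ → sym (override-other Fin._≟_ γ u c (x∈p[y]≔outside⇒x≢y B u x∈))) rep)
    (λ y y∈ → subst (λ z → z ⇔ SameCell w u y)
      (sym (cong₂ _≡_ (override-same Fin._≟_ γ u c)
                      (override-other Fin._≟_ γ u c (x∈p[y]≔outside⇒x≢y B u y∈))))
      (u-row y y∈))

module _ {k r : ℕ} {w : Witness k} {B : Subset (suc k)} {γ : Fin (suc k) → Fin r} (rep : Represents w B γ) where

  unusedColour : length w ≤ r → ∀ {u} → u ∈ ⋃ w → B ⊆ ⋃ w → (∀ {y} → y ∈ B → ¬ SameCell w u y) →
    ∃[ c ] ∀ {y} → y ∈ B → γ y ≢ c
  -- If every colour were used on B, a user of each colour would give an injection of the r colours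
  -- into the cells of w other than the cell of u.
  unusedColour |w|≤r {u} u∈⋃ B⊆⋃ u≁B with Fin.all? (λ c → Fin.any? (λ y → y ∈? B ×-dec γ y Fin.≟ c))
  ... | no ¬all-used =
    let c , c-unused = Fin.¬∀⟶∃¬ r _ (λ c → Fin.any? (λ y → y ∈? B ×-dec γ y Fin.≟ c)) ¬all-used
    in c , λ y∈ γy≡c → c-unused (_ , y∈ , γy≡c)
  ... | yes all-used = contradiction |w|≤r (ℕ.<⇒≱ (injective-avoiding⇒< cell-injective avoids-u))
    where
    user : Fin r → Fin (suc k)
    user c = proj₁ (all-used c)
    user∈B : ∀ c → user c ∈ B
    user∈B c = proj₁ (proj₂ (all-used c))
    cellOf : ∀ {x} → x ∈ ⋃ w → Fin (length w)
    cellOf x∈ = Any.index (∈⋃⁻ w x∈)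
    ∈cellOf : ∀ {x} (x∈ : x ∈ ⋃ w) → x ∈ List.lookup w (cellOf x∈)
    ∈cellOf x∈ = lookup-index (∈⋃⁻ w x∈)
    cell : Fin r → Fin (length w)
    cell c = cellOf (B⊆⋃ (user∈B c))
    cell-injective : Injective _≡_ _≡_ cell
    cell-injective {c} {d} eq = begin
      c             ≡⟨ proj₂ (proj₂ (all-used c)) ⟨
      γ (user c)    ≡⟨ Equivalence.from (rep _ _ (user∈B c) (user∈B d)) (lookup-sameCell _ (∈cellOf _)
                         (subst (λ i → _ ∈ List.lookup w i) (sym eq) (∈cellOf _))) ⟩
      γ (user d)    ≡⟨ proj₂ (proj₂ (all-used d)) ⟩
      d             ∎
      where open ≡-Reasoning
    avoids-u : ∀ c → cell c ≢ cellOf u∈⋃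
    avoids-u c eq = u≁B (user∈B c)
      (lookup-sameCell _ (∈cellOf u∈⋃) (subst (λ i → _ ∈ List.lookup w i) eq (∈cellOf _)))

  fewerCells : All Nonempty w → AllPairs Disjoint w → ⋃ w ⊆ B → ∀ {c} → (∀ {y} → y ∈ B → γ y ≢ c) →
    length w < r
  fewerCells nonempty disj ⋃⊆B c-unused =
    injective-avoiding⇒< colour-injective (λ i → c-unused (member∈B i))
    where
    member : Fin (length w) → Fin (suc k)
    member i = proj₁ (All.lookup nonempty (∈-lookup i))
    member∈ : ∀ i → member i ∈ List.lookup w i
    member∈ i = proj₂ (All.lookup nonempty (∈-lookup i))
    member∈B : ∀ i → member i ∈ B
    member∈B i = ⋃⊆B (∈⋃⁺ (lose (∈-lookup {xs = w} i) (member∈ i)))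
    colour-injective : Injective _≡_ _≡_ (γ ∘ member)
    colour-injective {i} {j} eq = sameCell-lookup-unique disj
      (Equivalence.to (rep _ _ (member∈B i) (member∈B j)) eq) (member∈ i) (member∈ j)

module _ {k : ℕ} where

  -- Colours are cell indices; labels outside ⋃ w get the junk colour zero, which is where r ≥ 1 is used.
  canonicalColouring : ∀ {r} (w : Witness k) → length w ≤ suc r → Fin (suc k) → Fin (suc r)
  canonicalColouring w |w|≤r x with Any.any? (x ∈?_) w
  ... | yes x∈w = inject≤ (Any.index x∈w) |w|≤r
  ... | no _    = zero

  canonicalColouring-represents : ∀ {r} {w : Witness k} (|w|≤r : length w ≤ suc r) → AllPairs Disjoint w →
    Represents w (⋃ w) (canonicalColouring w |w|≤r)
  canonicalColouring-represents {w = w} |w|≤r disj x y x∈ y∈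
    with Any.any? (x ∈?_) w | Any.any? (y ∈?_) w
  ... | yes x∈w | yes y∈w = mk⇔
    (λ eq → lookup-sameCell {w = w} _ (lookup-index x∈w)
      (subst (λ i → y ∈ List.lookup w i) (sym (Fin.inject≤-injective _ _ _ _ eq)) (lookup-index y∈w)))
    (λ x~y → cong (λ i → inject≤ i |w|≤r)
      (sameCell-lookup-unique disj x~y (lookup-index x∈w) (lookup-index y∈w)))
  ... | no x∉w | _        = contradiction (∈⋃⁻ w x∈) x∉w
  ... | _      | no y∉w   = contradiction (∈⋃⁻ w y∈) y∉w

module _ {k : ℕ} {B : Subset (suc k)} {θ : Fin (suc k) → ℕ} where

  private
    mapsTo : ℕ → Fin (suc k) → Bool
    mapsTo a u = lookup B u ∧ (θ u ℕ.≡ᵇ a)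

  preimage-sound : ∀ {a v} → preimage B θ a ≡ just v → v ∈ B × θ v ≡ a
  preimage-sound {a} {v} eq =
    let B∋v , θv≡a = Equivalence.to T-∧ (find-sound (T? ∘ mapsTo a) (List.allFin _) eq)
    in lookup⇒[]= v B (Equivalence.to T-≡ B∋v) , ℕ.≡ᵇ⇒≡ _ _ θv≡a

  preimage-θ : (∀ {x y} → x ∈ B → y ∈ B → θ x ≡ θ y → x ≡ y) →
    ∀ {u} → u ∈ B → preimage B θ (θ u) ≡ just u
  preimage-θ θ-inj {u} u∈B
    with v , eq ← find-complete (T? ∘ mapsTo (θ u)) (∈-allFin u)
                    (Equivalence.from T-∧ (Equivalence.from T-≡ ([]=⇒lookup u∈B) , ℕ.≡⇒≡ᵇ (θ u) _ refl))
    with refl ← θ-inj (proj₁ (preimage-sound eq)) u∈B (proj₂ (preimage-sound eq)) = eq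

  joinMap-view : ∀ θ₁ n a →
    (∃[ v ] v ∈ B × θ v ≡ a × joinMap B θ₁ θ n a ≡ θ₁ v) ⊎ joinMap B θ₁ θ n a ≡ n + a
  joinMap-view θ₁ n a with preimage B θ a in eq
  ... | just v  = inj₁ (v , proj₁ (preimage-sound eq) , proj₂ (preimage-sound eq) , refl)
  ... | nothing = inj₂ refl

  joinMap-θ : (∀ {x y} → x ∈ B → y ∈ B → θ x ≡ θ y → x ≡ y) →
    ∀ θ₁ n {u} → u ∈ B → joinMap B θ₁ θ n (θ u) ≡ θ₁ u
  joinMap-θ θ-inj θ₁ n u∈B = cong (ren θ₁ n _) (preimage-θ θ-inj u∈B)

module _ {k : ℕ} (θ : Fin (suc k) → ℕ) (u : Fin (suc k)) (n : ℕ) where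

  update-same : update θ u n u ≡ n
  update-same with u Fin.≟ u
  ... | yes _   = refl
  ... | no u≢u = contradiction refl u≢u

  update-other : ∀ {x} → x ≢ u → update θ u n x ≡ θ x
  update-other {x} x≢u with u Fin.≟ x
  ... | yes u≡x = contradiction (sym u≡x) x≢u
  ... | no _    = refl

module _ {k : ℕ} where

  freshOf : Term k → ℕ
  freshOf τ = Sem.fresh (sem τ)

  record WellFormed (τ : Term k) : Set where
    field
      θ<fresh     : ∀ {x} → x ∈ bag τ → thetaOf τ x < freshOf τ
      θ-injective : ∀ {x y} → x ∈ bag τ → y ∈ bag τ → thetaOf τ x ≡ thetaOf τ y → x ≡ y
      edge<fresh  : ∀ {e} → e ∈ₗ Graph.E (G τ) → proj₁ e < freshOf τ × proj₂ e < freshOf τ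

  open WellFormed

  wellFormed-introVertex : ∀ {u σ} → WellFormed σ → WellFormed (IntroVertex u σ)
  wellFormed-introVertex {u} {σ} wf = record
    { θ<fresh = θ′<fresh ; θ-injective = θ′-injective ; edge<fresh = λ e∈ → bump (edge<fresh wf e∈) }
    where
    f = freshOf σ
    θ′ = update (thetaOf σ) u f
    bump : ∀ {a b} → a < f × b < f → a < suc f × b < suc f
    bump (a<f , b<f) = ℕ.m<n⇒m<1+n a<f , ℕ.m<n⇒m<1+n b<f
    old : ∀ {x} → x ≢ u → x ∈ bag σ [ u ]≔ inside → x ∈ bag σ
    old x≢u = Equivalence.to (∈-[]≔-≢ x≢u)
    θ′-other : ∀ {x} → x ≢ u → θ′ x ≡ thetaOf σ x
    θ′-other = update-other (thetaOf σ) u f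
    θ′<fresh : ∀ {x} → x ∈ bag σ [ u ]≔ inside → θ′ x < suc f
    θ′<fresh {x} x∈ with x Fin.≟ u
    ... | yes refl = subst (_< suc f) (sym (update-same (thetaOf σ) u f)) (ℕ.n<1+n f)
    ... | no x≢u   = subst (_< suc f) (sym (θ′-other x≢u)) (ℕ.m<n⇒m<1+n (θ<fresh wf (old x≢u x∈)))
    θ′≢fresh : ∀ {x} → x ≢ u → x ∈ bag σ [ u ]≔ inside → θ′ x ≢ θ′ u
    θ′≢fresh x≢u x∈ eq = ℕ.<⇒≢ (θ<fresh wf (old x≢u x∈))
      (trans (sym (θ′-other x≢u)) (trans eq (update-same (thetaOf σ) u f)))
    θ′-injective : ∀ {x y} → x ∈ bag σ [ u ]≔ inside → y ∈ bag σ [ u ]≔ inside → θ′ x ≡ θ′ y → x ≡ y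
    θ′-injective {x} {y} x∈ y∈ eq with x Fin.≟ u | y Fin.≟ u
    ... | yes refl | yes refl = refl
    ... | yes refl | no y≢u   = contradiction (sym eq) (θ′≢fresh y≢u y∈)
    ... | no x≢u   | yes refl = contradiction eq (θ′≢fresh x≢u x∈)
    ... | no x≢u   | no y≢u   = θ-injective wf (old x≢u x∈) (old y≢u y∈)
                                  (trans (sym (θ′-other x≢u)) (trans eq (θ′-other y≢u)))

  wellFormed-join : ∀ {σ₁ σ₂} → WellFormed σ₁ → WellFormed σ₂ → bag σ₁ ≡ bag σ₂ → WellFormed (Join σ₁ σ₂)
  wellFormed-join {σ₁} {σ₂} wf₁ wf₂ bag₁≡bag₂ = record
    { θ<fresh = λ x∈ → shift₁ (θ<fresh wf₁ x∈)
    ; θ-injective = θ-injective wf₁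
    ; edge<fresh = edge<fresh′ }
    where
    f₁ = freshOf σ₁
    f₂ = freshOf σ₂
    jm = joinMap (bag σ₂) (thetaOf σ₁) (thetaOf σ₂) f₁
    shift₁ : ∀ {a} → a < f₁ → a < f₁ + f₂
    shift₁ a<f₁ = ℕ.<-≤-trans a<f₁ (ℕ.m≤m+n f₁ f₂)
    jm< : ∀ {a} → a < f₂ → jm a < f₁ + f₂
    jm< {a} a<f₂ with joinMap-view {B = bag σ₂} {θ = thetaOf σ₂} (thetaOf σ₁) f₁ a
    ... | inj₁ (v , v∈ , _ , jma≡θ₁v) =
      subst (_< f₁ + f₂) (sym jma≡θ₁v) (shift₁ (θ<fresh wf₁ (subst (v ∈_) (sym bag₁≡bag₂) v∈)))
    ... | inj₂ jma≡f₁+a = subst (_< f₁ + f₂) (sym jma≡f₁+a) (ℕ.+-monoʳ-< f₁ a<f₂)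
    edge<fresh′ : ∀ {e} → e ∈ₗ Graph.E (G σ₁) ++ map (mapEdge jm) (Graph.E (G σ₂)) →
      proj₁ e < f₁ + f₂ × proj₂ e < f₁ + f₂
    edge<fresh′ e∈ with ∈-++⁻ (Graph.E (G σ₁)) e∈
    ... | inj₁ e∈₁ = let a<f₁ , b<f₁ = edge<fresh wf₁ e∈₁ in shift₁ a<f₁ , shift₁ b<f₁
    ... | inj₂ e∈₂ with (a , b) , e′∈ , refl ← ∈-map⁻ (mapEdge jm) e∈₂ =
      let a<f₂ , b<f₂ = edge<fresh wf₂ e′∈ in jm< a<f₂ , jm< b<f₂

  wellFormed : ∀ {τ} → Legal τ → WellFormed τ
  wellFormed leaf = record
    { θ<fresh = λ x∈ → contradiction x∈ ∉⊥ ; θ-injective = λ x∈ → contradiction x∈ ∉⊥ ; edge<fresh = λ () }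
  wellFormed (introV legal _) = wellFormed-introVertex (wellFormed legal)
  wellFormed {ForgetVertex u σ} (forgetV legal _) = record
    { θ<fresh = θ<fresh wf ∘ old
    ; θ-injective = λ x∈ y∈ → θ-injective wf (old x∈) (old y∈)
    ; edge<fresh = edge<fresh wf }
    where
    wf = wellFormed legal
    old : ∀ {x} → x ∈ bag σ [ u ]≔ outside → x ∈ bag σ
    old x∈ = Equivalence.to (∈-[]≔-≢ (x∈p[y]≔outside⇒x≢y (bag σ) u x∈)) x∈
  wellFormed (introE legal u∈ v∈) = let wf = wellFormed legal in record
    { θ<fresh = θ<fresh wf ; θ-injective = θ-injective wf ; edge<fresh = λ where
        (here refl) → θ<fresh wf u∈ , θ<fresh wf v∈
        (there e∈)  → edge<fresh wf e∈ }
  wellFormed (join legal₁ legal₂ bag₁≡bag₂) =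
    wellFormed-join (wellFormed legal₁) (wellFormed legal₂) bag₁≡bag₂

module _ {k r : ℕ} where

  open ProperColouring
  open WellFormed

  Extendable : Term k → (Fin (suc k) → Fin r) → Set
  Extendable τ γ = Σ (ProperColouring r (G τ)) λ α → ∀ {x} → x ∈ bag τ → colour α (thetaOf τ x) ≡ γ x

  extendable-leaf : ∀ {γ} → Extendable Leaf γ
  extendable-leaf {γ} = record { colour = λ _ → γ zero ; proper = λ () } , λ x∈ → contradiction x∈ ∉⊥

  module _ {u : Fin (suc k)} {σ : Term k} {γ : Fin (suc k) → Fin r} where

    extendable-introVertex : WellFormed σ → u ∉ bag σ → Extendable (IntroVertex u σ) γ ⇔ Extendable σ γ
    extendable-introVertex wf u∉ = mk⇔ restrict extend
      where
      f = freshOf σ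
      off : ∀ {x} → x ∈ bag σ → x ≢ u
      off x∈ refl = u∉ x∈
      restrict : Extendable (IntroVertex u σ) γ → Extendable σ γ
      restrict (α , agrees) = record { colour = colour α ; proper = proper α } , λ x∈ →
        trans (cong (colour α) (sym (update-other (thetaOf σ) u f (off x∈))))
              (agrees ([]≔-minimal _ _ u (off x∈) x∈))
      extend : Extendable σ γ → Extendable (IntroVertex u σ) γ
      extend (α , agrees) = record { colour = α′ ; proper = proper′ } , agrees′
        where
        α′ = override ℕ._≟_ (colour α) f (γ u)
        old : ∀ {a} → a < f → α′ a ≡ colour α a
        old a<f = override-other ℕ._≟_ (colour α) f (γ u) (ℕ.<⇒≢ a<f)
        proper′ : ∀ {e} → e ∈ₗ Graph.E (G σ) → α′ (proj₁ e) ≢ α′ (proj₂ e)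
        proper′ e∈ eq = let a<f , b<f = edge<fresh wf e∈ in
          proper α e∈ (trans (sym (old a<f)) (trans eq (old b<f)))
        agrees′ : ∀ {x} → x ∈ bag σ [ u ]≔ inside → α′ (update (thetaOf σ) u f x) ≡ γ x
        agrees′ {x} x∈ with x Fin.≟ u
        ... | yes refl = trans (cong α′ (update-same (thetaOf σ) u f)) (override-same ℕ._≟_ (colour α) f (γ u))
        ... | no x≢u   = let x∈σ = Equivalence.to (∈-[]≔-≢ x≢u) x∈ in
          trans (cong α′ (update-other (thetaOf σ) u f x≢u)) (trans (old (θ<fresh wf x∈σ)) (agrees x∈σ))

    extendable-forgetVertex : Extendable (ForgetVertex u σ) γ ⇔ (∃[ c ] Extendable σ (override Fin._≟_ γ u c))
    extendable-forgetVertex = mk⇔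
      (λ (α , agrees) → colour α (thetaOf σ u) , α , λ {x} x∈ → agrees′ α agrees x∈ (x Fin.≟ u))
      (λ (c , α , agrees) → α , λ x∈ → let x≢u = x∈p[y]≔outside⇒x≢y _ u x∈ in
        trans (agrees (Equivalence.to (∈-[]≔-≢ x≢u) x∈)) (override-other Fin._≟_ γ u c x≢u))
      where
      agrees′ : ∀ (α : ProperColouring r (G σ)) →
        (∀ {x} → x ∈ bag σ [ u ]≔ outside → colour α (thetaOf σ x) ≡ γ x) →
        ∀ {x} → x ∈ bag σ → Dec (x ≡ u) →
        colour α (thetaOf σ x) ≡ override Fin._≟_ γ u (colour α (thetaOf σ u)) x
      agrees′ α agrees x∈ (yes refl) = sym (override-same Fin._≟_ γ u _)
      agrees′ α agrees x∈ (no x≢u)   =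
        trans (agrees ([]≔-minimal _ _ u x≢u x∈)) (sym (override-other Fin._≟_ γ u _ x≢u))

  module _ {u v : Fin (suc k)} {u≢v : u ≢ v} {σ : Term k} {γ : Fin (suc k) → Fin r} where

    extendable-introEdge : u ∈ bag σ → v ∈ bag σ →
      Extendable (IntroEdge u v u≢v σ) γ ⇔ (γ u ≢ γ v × Extendable σ γ)
    extendable-introEdge u∈ v∈ = mk⇔
      (λ (α , agrees) → (λ γu≡γv → proper α (here refl) (trans (agrees u∈) (trans γu≡γv (sym (agrees v∈))))) ,
                        record { colour = colour α ; proper = proper α ∘ there } , agrees)
      (λ (γu≢γv , α , agrees) → record { colour = colour α ; proper = λ where
          (here refl) eq → γu≢γv (trans (sym (agrees u∈)) (trans eq (agrees v∈)))
          (there e∈)     → proper α e∈ } , agrees)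

  module _ {σ₁ σ₂ : Term k} {γ : Fin (suc k) → Fin r}
           (wf₁ : WellFormed σ₁) (wf₂ : WellFormed σ₂) (bag₁≡bag₂ : bag σ₁ ≡ bag σ₂) where

    private
      f₁ = freshOf σ₁
      jm = joinMap (bag σ₂) (thetaOf σ₁) (thetaOf σ₂) f₁
      to₁ : ∀ {x} → x ∈ bag σ₂ → x ∈ bag σ₁
      to₁ {x} = subst (x ∈_) (sym bag₁≡bag₂)

    extendable-join : Extendable (Join σ₁ σ₂) γ ⇔ (Extendable σ₁ γ × Extendable σ₂ γ)
    extendable-join = mk⇔ split glue
      where
      split : Extendable (Join σ₁ σ₂) γ → Extendable σ₁ γ × Extendable σ₂ γ
      split (α , agrees) =
        (record { colour = colour α ; proper = proper α ∘ ∈-++⁺ˡ } , agrees) ,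
        (record { colour = colour α ∘ jm ; proper = proper α ∘ ∈-++⁺ʳ _ ∘ ∈-map⁺ (mapEdge jm) } , λ x∈ →
          trans (cong (colour α) (joinMap-θ (θ-injective wf₂) (thetaOf σ₁) f₁ x∈)) (agrees (to₁ x∈)))

      glue : Extendable σ₁ γ × Extendable σ₂ γ → Extendable (Join σ₁ σ₂) γ
      glue ((α₁ , agrees₁) , (α₂ , agrees₂)) = record { colour = β ; proper = proper′ } , λ x∈ →
        trans (β-left (θ<fresh wf₁ x∈)) (agrees₁ x∈)
        where
        -- Vertices below f₁ come from σ₁; joinMap puts the unglued vertices a of σ₂ at f₁ + a.
        β : ℕ → Fin r
        β y with y ℕ.<? f₁
        ... | yes _ = colour α₁ y
        ... | no  _ = colour α₂ (y ∸ f₁)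
        β-left : ∀ {y} → y < f₁ → β y ≡ colour α₁ y
        β-left {y} y<f₁ with y ℕ.<? f₁
        ... | yes _    = refl
        ... | no  y≮f₁ = contradiction y<f₁ y≮f₁
        β-right : ∀ a → β (f₁ + a) ≡ colour α₂ a
        β-right a with (f₁ + a) ℕ.<? f₁
        ... | yes f₁+a<f₁ = contradiction f₁+a<f₁ (ℕ.m+n≮m f₁ a)
        ... | no  _       = cong (colour α₂) (ℕ.m+n∸m≡n f₁ a)
        β-jm : ∀ a → β (jm a) ≡ colour α₂ a
        β-jm a with joinMap-view {B = bag σ₂} {θ = thetaOf σ₂} (thetaOf σ₁) f₁ a
        ... | inj₁ (v , v∈ , θ₂v≡a , jma≡θ₁v) = begin
          β (jm a)                   ≡⟨ cong β jma≡θ₁v ⟩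
          β (thetaOf σ₁ v)           ≡⟨ β-left (θ<fresh wf₁ (to₁ v∈)) ⟩
          colour α₁ (thetaOf σ₁ v)   ≡⟨ agrees₁ (to₁ v∈) ⟩
          γ v                        ≡⟨ agrees₂ v∈ ⟨
          colour α₂ (thetaOf σ₂ v)   ≡⟨ cong (colour α₂) θ₂v≡a ⟩
          colour α₂ a                ∎
          where open ≡-Reasoning
        ... | inj₂ jma≡f₁+a = trans (cong β jma≡f₁+a) (β-right a)
        proper′ : ∀ {e} → e ∈ₗ Graph.E (G σ₁) ++ map (mapEdge jm) (Graph.E (G σ₂)) →
          β (proj₁ e) ≢ β (proj₂ e)
        proper′ e∈ eq with ∈-++⁻ (Graph.E (G σ₁)) e∈
        ... | inj₁ e∈₁ = let a<f₁ , b<f₁ = edge<fresh wf₁ e∈₁ in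
          proper α₁ e∈₁ (trans (sym (β-left a<f₁)) (trans eq (β-left b<f₁)))
        ... | inj₂ e∈₂ with (a , b) , e′∈ , refl ← ∈-map⁻ (mapEdge jm) e∈₂ =
          proper α₂ e′∈ (trans (sym (β-jm a)) (trans eq (β-jm b)))

-- Soundness

module _ {k r : ℕ} where

  record IsPartition (B : Subset (suc k)) (w : Witness k) : Set where
    field
      covers   : ⋃ w ≡ B
      disjoint : AllPairs Disjoint w
      bounded  : length w ≤ r

  open IsPartition

  isPartition-resp-↭ : ∀ {B w w′} → w ↭ w′ → IsPartition B w → IsPartition B w′
  isPartition-resp-↭ w↭w′ P = record
    { covers   = trans (sym (⋃-resp-↭ w↭w′)) (covers P)
    ; disjoint = allPairs-disjoint-resp-↭ w↭w′ (disjoint P)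
    ; bounded  = subst (_≤ r) (↭-length w↭w′) (bounded P) }

  dyn-isPartition : ∀ {τ w} → Dyn r τ w → IsPartition (bag τ) w
  dyn-isPartition (leaf w↭[]) =
    isPartition-resp-↭ (↭-sym w↭[]) (record { covers = refl ; disjoint = [] ; bounded = z≤n })
  dyn-isPartition (introV {u = u} d t) = let P = dyn-isPartition d in record
    { covers   = trans (introVertexT-⋃ t) (cong (_[ u ]≔ inside) (covers P))
    ; disjoint = introVertexT-disjoint t (disjoint P)
    ; bounded  = introVertexT-length t (bounded P) }
  dyn-isPartition (forgetV {u = u} {w = w} d t) = let P = dyn-isPartition d in record
    { covers   = trans (forgetVertexT-⋃ {w = w} t) (cong (_[ u ]≔ outside) (covers P))
    ; disjoint = forgetVertexT-disjoint {w = w} t (disjoint P)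
    ; bounded  = ℕ.≤-trans (forgetVertexT-length {w = w} t) (bounded P) }
  dyn-isPartition (introE d (_ , w′↭w))       = isPartition-resp-↭ (↭-sym w′↭w) (dyn-isPartition d)
  dyn-isPartition (join d₁ _ (_ , w′↭w₁))     = isPartition-resp-↭ (↭-sym w′↭w₁) (dyn-isPartition d₁)

  forgottenColour : ∀ {B w u} {γ : Fin (suc k) → Fin r} → IsPartition B w → u ∈ B →
    Represents w (B [ u ]≔ outside) γ → ∃[ c ] ∀ y → y ∈ B [ u ]≔ outside → c ≡ γ y ⇔ SameCell w u y
  forgottenColour {B} {w} {u} {γ} P u∈B rep with Fin.any? (λ v → v ∈? B [ u ]≔ outside ×-dec sameCell? u v)
  ... | yes (v , v∈ , u~v) = γ v , represents-sameCell (disjoint P) rep v∈ u~v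
  ... | no ¬shared =
    let c , c-unused = unusedColour rep (bounded P) u∈⋃ B′⊆⋃ (λ y∈ u~y → ¬shared (_ , y∈ , u~y))
    in c , λ y y∈ → mk⇔ (λ c≡γy → contradiction (sym c≡γy) (c-unused y∈))
                         (λ u~y → contradiction (y , y∈ , u~y) ¬shared)
    where
    u∈⋃ : u ∈ ⋃ w
    u∈⋃ = subst (u ∈_) (sym (covers P)) u∈B
    B′⊆⋃ : B [ u ]≔ outside ⊆ ⋃ w
    B′⊆⋃ {y} y∈ =
      subst (y ∈_) (sym (covers P)) (Equivalence.to (∈-[]≔-≢ (x∈p[y]≔outside⇒x≢y B u y∈)) y∈)

  dyn⇒extendable : ∀ {τ w} → Legal τ → Dyn r τ w → ∀ {γ} → Represents w (bag τ) γ → Extendable τ γ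
  dyn⇒extendable leaf (leaf _) _ = extendable-leaf
  dyn⇒extendable (introV legal u∉) (introV d t) rep =
    Equivalence.from (extendable-introVertex (wellFormed legal) u∉)
      (dyn⇒extendable legal d (represents-introVertex u∉ (introVertexT-agreeOff t) rep))
  dyn⇒extendable {ForgetVertex u σ} (forgetV legal u∈) (forgetV {w = w} d t) rep =
    let rep′ = represents-forgotten {w = w} t rep
        c , u-row = forgottenColour (dyn-isPartition d) u∈ rep′
        u∈⋃ = subst (_ ∈_) (sym (covers (dyn-isPartition d))) u∈
    in Equivalence.from (extendable-forgetVertex {σ = σ})
         (c , dyn⇒extendable legal d (represents-override u∈⋃ rep′ u-row))
  dyn⇒extendable {IntroEdge u v u≢v σ} (introE legal u∈ v∈) (introE d (u≁v , w′↭w)) rep =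
    Equivalence.from (extendable-introEdge {u≢v = u≢v} {σ = σ} u∈ v∈)
      ( (λ γu≡γv → u≁v (Equivalence.to (sameCell-resp-↭ w′↭w) (Equivalence.to (rep _ _ u∈ v∈) γu≡γv)))
      , dyn⇒extendable legal d (represents-↭ w′↭w rep))
  dyn⇒extendable (join legal₁ legal₂ bag₁≡bag₂) (join d₁ d₂ (w₁↭w₂ , w′↭w₁)) {γ} rep =
    let rep₁ = represents-↭ w′↭w₁ rep
        rep₂ = subst (λ B → Represents _ B γ) bag₁≡bag₂ (represents-↭ w₁↭w₂ rep₁)
    in Equivalence.from (extendable-join (wellFormed legal₁) (wellFormed legal₂) bag₁≡bag₂)
         (dyn⇒extendable legal₁ d₁ rep₁ , dyn⇒extendable legal₂ d₂ rep₂)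

dyn⇒pred : ∀ {k r} {τ : Term k} {w} → Legal τ → Dyn (suc r) τ w → Pred (suc r) τ w
dyn⇒pred {w = w} legal d =
  covers P , α , represents-cong (sym ∘ agrees) rep
  where
  open IsPartition
  P = dyn-isPartition d
  γ = canonicalColouring w (bounded P)
  rep : Represents w _ γ
  rep = subst (λ B → Represents w B γ) (covers P) (canonicalColouring-represents (bounded P) (disjoint P))
  ext = dyn⇒extendable legal d rep
  α = proj₁ ext
  agrees = proj₂ ext

-- Completeness

module _ {k r : ℕ} {u : Fin (suc k)} {w w′ : Witness k} {B : Subset (suc k)} where

  introVertexT-covers : IntroVertexT r u w w′ → ⋃ w′ ≡ B [ u ]≔ inside → u ∉ B → ⋃ w ≡ B
  introVertexT-covers t covers′ u∉B = []≔-cancel u (trans (sym (introVertexT-⋃ t)) covers′)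
    (trans (∉⇒lookup≡outside (⋃ w) u (proj₁ t)) (sym (∉⇒lookup≡outside B u u∉B)))

module _ {k : ℕ} {u : Fin (suc k)} {w w′ : Witness k} {B : Subset (suc k)} where

  forgetVertexT-covers : ForgetVertexT u w w′ → ⋃ w′ ≡ B [ u ]≔ outside → u ∈ B → ⋃ w ≡ B
  forgetVertexT-covers t covers′ u∈B = []≔-cancel u (trans (sym (forgetVertexT-⋃ {w = w} t)) covers′)
    (trans ([]=⇒lookup (proj₁ t)) (sym ([]=⇒lookup u∈B)))

module _ {k r : ℕ} {u : Fin (suc k)} {w′ : Witness k} (local′ : IsLocalWitness r w′) where

  private
    nonempty′ = proj₁ local′
    disjoint′ = proj₁ (proj₂ local′)
    bounded′  = proj₂ (proj₂ local′)

  module _ {q R} (w′↭ : w′ ↭ q ∷ R) where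

    private
      disjoint-qR = allPairs-disjoint-resp-↭ w′↭ disjoint′
      nonempty-qR = All-resp-↭ w′↭ nonempty′
      |R|<r : length R < r
      |R|<r = subst (_≤ r) (↭-length w′↭) bounded′

    introVertex-predecessor : u ∈ q → ∃[ w ] IntroVertexT r u w w′ × IsLocalWitness r w
    introVertex-predecessor u∈q with nonempty? (q - u)
    ... | yes q-u≢∅ = (q - u) ∷ R
      , ( All¬⇒¬Any (x∉p-x ∷ u∉R) ∘ ∈⋃⁻ _
        , inj₁ (q - u , here refl , subst (λ c → w′ ↭ c ∷ R) (sym (x∈p⇒p-x∪⁅x⁆≡p u∈q)) w′↭))
      , ( q-u≢∅ ∷ All.tail nonempty-qR
        , All.map (disjoint-mono (p─q⊆p _ _) (λ x∈ → x∈)) (AllPairs.head disjoint-qR)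
            ∷ AllPairs.tail disjoint-qR
        , |R|<r)
      where
      u∉R : All (u ∉_) R
      u∉R = All.map (λ q∩c≡∅ → disjoint⇒∉ q∩c≡∅ u∈q) (AllPairs.head disjoint-qR)
    ... | no q-u≡∅ = R
      , ( All¬⇒¬Any u∉R ∘ ∈⋃⁻ _
        , inj₂ (|R|<r , subst (λ c → w′ ↭ c ∷ R) (x∈p∧Empty[p-x]⇒p≡⁅x⁆ u∈q q-u≡∅) w′↭))
      , (All.tail nonempty-qR , AllPairs.tail disjoint-qR , ℕ.<⇒≤ |R|<r)
      where
      u∉R : All (u ∉_) R
      u∉R = All.map (λ q∩c≡∅ → disjoint⇒∉ q∩c≡∅ u∈q) (AllPairs.head disjoint-qR)

    forgetVertex-joinCell : u ∉ ⋃ w′ →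
      ForgetVertexT u ((q ∪ ⁅ u ⁆) ∷ R) w′ × IsLocalWitness r ((q ∪ ⁅ u ⁆) ∷ R)
    forgetVertex-joinCell u∉⋃w′ =
      ( ∈⋃⁺ {w = (q ∪ ⁅ u ⁆) ∷ R} (here x∈p∪⁅x⁆)
      , ↭-trans w′↭ (↭-reflexive (sym (trans (removeLabel-∪⁅⁆ {p = q} {w = R})
                                             (removeLabel-fresh u∉qR nonempty-qR)))))
      , ( (u , x∈p∪⁅x⁆) ∷ All.tail nonempty-qR
        , allPairs-disjoint-∪⁅⁆ (All.tail u∉qR) disjoint-qR
        , ℕ.≤-trans (ℕ.≤-reflexive (sym (↭-length w′↭))) bounded′)
      where
      u∉qR : All (u ∉_) (q ∷ R)
      u∉qR = ∉⋃⇒∉cells (subst (u ∉_) (⋃-resp-↭ w′↭) u∉⋃w′)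

  forgetVertex-newCell : u ∉ ⋃ w′ → length w′ < r →
    ForgetVertexT u (⁅ u ⁆ ∷ w′) w′ × IsLocalWitness r (⁅ u ⁆ ∷ w′)
  forgetVertex-newCell u∉⋃w′ |w′|<r =
    ( ∈⋃⁺ {w = ⁅ u ⁆ ∷ w′} (here (x∈⁅x⁆ u))
    , ↭-reflexive (sym (trans (removeLabel-⁅⁆ {w = w′}) (removeLabel-fresh u∉w′ nonempty′))))
    , ((u , x∈⁅x⁆ u) ∷ nonempty′ , allPairs-disjoint-⁅⁆∷ u∉w′ disjoint′ , |w′|<r)
    where
    u∉w′ : All (u ∉_) w′
    u∉w′ = ∉⋃⇒∉cells u∉⋃w′

module _ {k r : ℕ} where

  DynComplete : Term k → Set
  DynComplete τ = ∀ {w} {γ : Fin (suc k) → Fin r} → IsLocalWitness r w → ⋃ w ≡ bag τ →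
    Represents w (bag τ) γ → Extendable τ γ → Dyn r τ w

  dynComplete-introVertex : ∀ {u σ} → WellFormed σ → u ∉ bag σ → DynComplete σ →
    DynComplete (IntroVertex u σ)
  dynComplete-introVertex {u} {σ} wf u∉σ complete {w′} local′ covers′ rep′ ext′ =
    let q , q∈w′ , u∈q = find (∈⋃⁻ w′ (subst (u ∈_) (sym covers′) ([]≔-updates (bag σ) u)))
        w , t , local = introVertex-predecessor local′ (↭-extract q∈w′) u∈q
    in introV (complete local (introVertexT-covers t covers′ u∉σ)
                 (represents-introVertex u∉σ (introVertexT-agreeOff t) rep′)
                 (Equivalence.to (extendable-introVertex wf u∉σ) ext′))
              t

  dynComplete-forgetVertex : ∀ {u σ} → u ∈ bag σ → DynComplete σ → DynComplete (ForgetVertex u σ)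
  dynComplete-forgetVertex {u} {σ} u∈σ complete {w′} {γ} local′ covers′ rep′ ext′ =
    let c , ext = Equivalence.to (extendable-forgetVertex {σ = σ}) ext′
    in by-colour ext (Fin.any? (λ v → v ∈? bag σ [ u ]≔ outside ×-dec γ v Fin.≟ c))
    where
    u∉⋃w′ : u ∉ ⋃ w′
    u∉⋃w′ u∈ = x∈p[y]≔outside⇒x≢y (bag σ) u (subst (u ∈_) covers′ u∈) refl
    alone : ∀ {y} → y ∈ bag σ [ u ]≔ outside → ¬ SameCell (⁅ u ⁆ ∷ w′) u y
    alone y∈ (_ , here refl , _ , y∈⁅u⁆)  = x∈p[y]≔outside⇒x≢y (bag σ) u y∈ (x∈⁅y⁆⇒x≡y u y∈⁅u⁆)
    alone y∈ (c , there c∈w′ , u∈c , _) = u∉⋃w′ (∈⋃⁺ (lose c∈w′ u∈c))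
    by-colour : ∀ {c} → Extendable σ (override Fin._≟_ γ u c) →
      Dec (∃[ v ] v ∈ bag σ [ u ]≔ outside × γ v ≡ c) → Dyn r (ForgetVertex u σ) w′
    by-colour {c} ext (yes (v , v∈ , γv≡c)) =
      let q , q∈w′ , v∈q = find (∈⋃⁻ w′ (subst (v ∈_) (sym covers′) v∈))
          t , local = forgetVertex-joinCell local′ (↭-extract q∈w′) u∉⋃w′
          rep = represents-forgotten t rep′
          u~v = _ , here refl , x∈p∪⁅x⁆ , x∈p∪q⁺ (inj₁ v∈q)
          u-row = λ y y∈ → subst (λ c → c ≡ γ y ⇔ _) γv≡c
                    (represents-sameCell (proj₁ (proj₂ local)) rep v∈ u~v y y∈)
      in forgetV (complete local (forgetVertexT-covers {w = (q ∪ ⁅ u ⁆) ∷ _} t covers′ u∈σ)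
                    (represents-override (proj₁ t) rep u-row) ext) t
    by-colour {c} ext (no c-unused) =
      let t , local = forgetVertex-newCell local′ u∉⋃w′
                        (fewerCells rep′ (proj₁ local′) (proj₁ (proj₂ local′)) (λ {y} → subst (y ∈_) covers′)
                          (λ y∈ γy≡c → c-unused (_ , y∈ , γy≡c)))
          u-row = λ y y∈ → mk⇔ (λ c≡γy → contradiction (y , y∈ , sym c≡γy) c-unused)
                               (λ u~y → contradiction u~y (alone y∈))
      in forgetV (complete local (forgetVertexT-covers {w = ⁅ u ⁆ ∷ w′} t covers′ u∈σ)
                    (represents-override (proj₁ t) (represents-forgotten t rep′) u-row) ext) t

  dynComplete : ∀ {τ} → Legal τ → DynComplete τ
  dynComplete leaf {[]}    _                     _      _ _ = leaf ↭-refl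
  dynComplete leaf {p ∷ w} ((x , x∈p) ∷ _ , _) covers _ _ =
    contradiction (subst (x ∈_) covers (∈⋃⁺ {w = p ∷ w} (here x∈p))) ∉⊥
  dynComplete (introV legal u∉σ) = dynComplete-introVertex (wellFormed legal) u∉σ (dynComplete legal)
  dynComplete (forgetV legal u∈σ) = dynComplete-forgetVertex u∈σ (dynComplete legal)
  dynComplete {IntroEdge u v u≢v σ} (introE legal u∈ v∈) local covers rep ext =
    let γu≢γv , ext′ = Equivalence.to (extendable-introEdge {u≢v = u≢v} {σ = σ} u∈ v∈) ext
    in introE (dynComplete legal local covers rep ext′) (γu≢γv ∘ Equivalence.from (rep u v u∈ v∈) , ↭-refl)
  dynComplete (join legal₁ legal₂ bag₁≡bag₂) local covers rep ext =
    let ext₁ , ext₂ = Equivalence.to (extendable-join (wellFormed legal₁) (wellFormed legal₂) bag₁≡bag₂) ext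
        rep₂ = subst (λ B → Represents _ B _) bag₁≡bag₂ rep
    in join (dynComplete legal₁ local covers rep ext₁)
            (dynComplete legal₂ local (trans covers bag₁≡bag₂) rep₂ ext₂)
            (↭-refl , ↭-refl)

  pred⇒dyn : ∀ {τ w} → Legal τ → IsLocalWitness r w → Pred r τ w → Dyn r τ w
  pred⇒dyn legal local (covers , α , rep) = dynComplete legal local covers rep (α , λ _ → refl)

proposition1 : (k r : ℕ) → 1 ≤ r → (τ : Term k) → Legal τ →
    (w : Witness k) → IsLocalWitness r w → (Dyn r τ w ⇔ Pred r τ w)
proposition1 k (suc r) _ τ legal w local = mk⇔ (dyn⇒pred legal) (pred⇒dyn legal local)
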